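{- Let $n\ge 2$ and let $\mathrm L$ be the tabular logic $\models_{(\mathbf A,\mathsf t)}$ of type $\tau$, where $\mathbf A$ is a $\tau$-algebra with $|A|=n$ and $\mathsf t\in A$, with $A$ identified with $\{\mathsf e_1,\dots,\mathsf e_n\}$ so that $\mathsf t=\mathsf e_n$. With the translation $\phi\mapsto\phi^*$ described in the context, $n\mathrm{CL}$ is a conservative expansion of $\mathrm L$: for every set $\Gamma\cup\{\phi\}$ of $\tau$-formulas, $\Gamma\models_{(\mathbf A,\mathsf t)}\phi$ if and only if $\Gamma^*\models_{(\mathbf n,\mathsf e_n)}\phi^*$.
   Context: $\nu_n$ is the type with one $(n+1)$-ary symbol $q$ and constants $\mathsf e_1,\dots,\mathsf e_n$. The algebra $\mathbf n$ has universe $\{\mathsf e_1,\dots,\mathsf e_n\}$, constants interpreted as themselves and $q^{\mathbf n}(\mathsf e_j,x_1,\dots,x_n)=x_j$. For a type $\sigma$, $\sigma$-formulas are $\sigma$-terms over a fixed countable set of variables. For an algebra $\mathbf B$ of type $\sigma$ and $d\in B$, $\Gamma\models_{(\mathbf B,d)}\phi$ means: for every homomorphism $h$ from the $\sigma$-formula algebra to $\mathbf B$, if $h(\psi)=d$ for all $\psi\in\Gamma$ then $h(\phi)=d$; such a consequence relation with $\mathbf B$ finite is a tabular logic. $n\mathrm{CL}$ is $\models_{(\mathbf n,\mathsf e_n)}$. Translation: for each $k$-ary operation symbol $f$ of $\tau$ (regarding $f^{\mathbf A}$ as a function $\{\mathsf e_1,\dots,\mathsf e_n\}^k\to\{\mathsf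 e_1,\dots,\mathsf e_n\}$), fix a head normal form $f^\circ(x_1,\dots,x_k)$ of type $\nu_n$ whose term function on $\mathbf n$ equals $f^{\mathbf A}$ (head normal forms are generated by $t,t_i::=\mathsf e_i\mid x\mid q(x,t_1,\dots,t_n)$, $x$ a variable; such $f^\circ$ always exists). Then $x^*=x$ for variables and $f(\phi_1,\dots,\phi_k)^*=f^\circ(\phi_1^*/x_1,\dots,\phi_k^*/x_k)$; $\Gamma^*=\{\psi^*:\psi\in\Gamma\}$. -}

module Defs where

open import Data.Nat using (ℕ; suc)
open import Data.Fin using (Fin)
open import Data.Vec using (Vec; []; _∷_; lookup; tabulate)
open import Data.Product using (Σ; ∃; _×_; _,_)
open import Relation.Binary.PropositionalEquality using (_≡_)

record Signature : Set₁ where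
  field
    Op    : Set
    arity : Op → ℕ
open Signature public

data Term (σ : Signature) (V : Set) : Set where
  var : V → Term σ V
  app : (f : Op σ) → Vec (Term σ V) (arity σ f) → Term σ V

Formula : Signature → Set
Formula σ = Term σ ℕ

record Algebra (σ : Signature) : Set₁ where
  field
    Carrier : Set
    interp  : (f : Op σ) → Vec Carrier (arity σ f) → Carrier
open Algebra public

-- Term evaluation under an assignment of the variables.  Homomorphisms from the
-- formula algebra to B are exactly the maps ⟦_⟧ B h for h : ℕ → Carrier B.
mutual
  ⟦_⟧ : ∀ {σ V} (B : Algebra σ) → (V → Carrier B) → Term σ V → Carrier B
  ⟦ B ⟧ h (var x)    = h x
  ⟦ B ⟧ h (app f ts) = interp B f (⟦ B ⟧* h ts)

  ⟦_⟧* : ∀ {σ V k} (B : Algebra σ) → (V → Carrier B) → Vec (Term σ V) k → Vec (Carrier B) k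
  ⟦ B ⟧* h []       = []
  ⟦ B ⟧* h (t ∷ ts) = ⟦ B ⟧ h t ∷ ⟦ B ⟧* h ts

FSet : Signature → Set₁
FSet σ = Formula σ → Set

_⊨⟨_,_⟩_ : ∀ {σ} → FSet σ → (B : Algebra σ) → Carrier B → Formula σ → Set
Γ ⊨⟨ B , d ⟩ φ = (h : ℕ → Carrier B) → (∀ ψ → Γ ψ → ⟦ B ⟧ h ψ ≡ d) → ⟦ B ⟧ h φ ≡ d

data νOp (n : ℕ) : Set where
  q : νOp n
  e : Fin n → νOp n

νarity : ∀ {n} → νOp n → ℕ
νarity {n} q = suc n
νarity (e _) = 0

ν : ℕ → Signature
ν n = record { Op = νOp n ; arity = νarity }

𝐧interp : ∀ {n} (f : νOp n) → Vec (Fin n) (νarity f) → Fin n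
𝐧interp q (c ∷ xs) = lookup xs c
𝐧interp (e i) [] = i

𝐧 : (n : ℕ) → Algebra (ν n)
𝐧 n = record { Carrier = Fin n ; interp = 𝐧interp }

data IsHNF {n : ℕ} {V : Set} : Term (ν n) V → Set
data AllHNF {n : ℕ} {V : Set} : ∀ {k} → Vec (Term (ν n) V) k → Set

data IsHNF {n} {V} where
  hnf-e   : (i : Fin n) → IsHNF (app (e i) [])
  hnf-var : (x : V) → IsHNF (var x)
  hnf-q   : (x : V) (ts : Vec (Term (ν n) V) n) → AllHNF ts → IsHNF (app q (var x ∷ ts))

data AllHNF {n} {V} where
  []  : AllHNF []
  _∷_ : ∀ {k t} {ts : Vec (Term (ν n) V) k} → IsHNF t → AllHNF ts → AllHNF (t ∷ ts)

mutual
  subst : ∀ {σ V W} → (V → Term σ W) → Term σ V → Term σ W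
  subst s (var x)    = s x
  subst s (app f ts) = app f (subst* s ts)

  subst* : ∀ {σ V W k} → (V → Term σ W) → Vec (Term σ V) k → Vec (Term σ W) k
  subst* s []       = []
  subst* s (t ∷ ts) = subst s t ∷ subst* s ts

FinAlgebra : Signature → ℕ → Set
FinAlgebra τ n = (f : Op τ) → Vec (Fin n) (arity τ f) → Fin n

toAlgebra : ∀ {τ n} → FinAlgebra τ n → Algebra τ
toAlgebra {n = n} ops = record { Carrier = Fin n ; interp = ops }

record HNFChoice {τ : Signature} {n : ℕ} (A : FinAlgebra τ n) : Set where
  field
    _° : (f : Op τ) → Term (ν n) (Fin (arity τ f))
    °-hnf : (f : Op τ) → IsHNF (f °)
    °-correct : (f : Op τ) (ρ : Fin (arity τ f) → Fin n) → ⟦ 𝐧 n ⟧ ρ (f °) ≡ A f (tabulate ρ)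

module Translation {τ : Signature} {n : ℕ} {A : FinAlgebra τ n} (C : HNFChoice A) where
  open HNFChoice C

  mutual
    _* : Formula τ → Formula (ν n)
    var x * = var x
    app f φs * = subst (lookup (φs *v)) (f °)

    _*v : ∀ {k} → Vec (Formula τ) k → Vec (Formula (ν n)) k
    [] *v = []
    (φ ∷ φs) *v = (φ *) ∷ (φs *v)

  _*s : FSet τ → FSet (ν n)
  (Γ *s) χ = Σ (Formula τ) (λ ψ → Γ ψ × (ψ *) ≡ χ)

module Submission where

-- The whole argument rests on one semantic fact: for every valuation h into
-- {e_1,…,e_n}, the translation φ ↦ φ* preserves values,
--     ⟦ 𝐧 ⟧ h (φ*) = ⟦ A ⟧ h φ,
-- because each f° computes f^A on 𝐧 and evaluation commutes with
-- substitution.  Since A and 𝐧 share their universe, the valuations of the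
-- two formula algebras are literally the same maps ℕ → Fin n, so a
-- value-preserving translation transfers consequence in both directions.

open import Defs
open import Data.Nat using (ℕ; suc)
open import Data.Fin using (Fin; fromℕ; zero; suc)
open import Data.Vec using (Vec; []; _∷_; lookup; tabulate)
open import Data.Vec.Properties using (tabulate∘lookup; tabulate-cong)
open import Data.Product using (Σ; _×_; _,_)
open import Function.Bundles using (_⇔_; mk⇔)
open import Relation.Binary.PropositionalEquality
  using (_≡_; refl; sym; trans; cong; cong₂; module ≡-Reasoning)

mutual
  eval-subst : ∀ {σ V W} (B : Algebra σ) (h : W → Carrier B) (s : V → Term σ W) (t : Term σ V) →
               ⟦ B ⟧ h (subst s t) ≡ ⟦ B ⟧ (λ x → ⟦ B ⟧ h (s x)) t
  eval-subst B h s (var x)    = refl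
  eval-subst B h s (app f ts) = cong (interp B f) (eval-subst* B h s ts)

  eval-subst* : ∀ {σ V W k} (B : Algebra σ) (h : W → Carrier B) (s : V → Term σ W)
                (ts : Vec (Term σ V) k) →
                ⟦ B ⟧* h (subst* s ts) ≡ ⟦ B ⟧* (λ x → ⟦ B ⟧ h (s x)) ts
  eval-subst* B h s []       = refl
  eval-subst* B h s (t ∷ ts) = cong₂ _∷_ (eval-subst B h s t) (eval-subst* B h s ts)

algebraOn : ∀ {σ} {D : Set} → ((f : Op σ) → Vec D (arity σ f) → D) → Algebra σ
algebraOn {D = D} I = record { Carrier = D ; interp = I }

image : ∀ {σ σ′} → (Formula σ → Formula σ′) → FSet σ → FSet σ′
image {σ} T Γ χ = Σ (Formula σ) (λ ψ → Γ ψ × T ψ ≡ χ)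

conservative-transfer :
  ∀ {σ σ′} {D : Set} (I : (f : Op σ) → Vec D (arity σ f) → D)
  (I′ : (f : Op σ′) → Vec D (arity σ′ f) → D) (T : Formula σ → Formula σ′) →
  (∀ (h : ℕ → D) φ → ⟦ algebraOn I′ ⟧ h (T φ) ≡ ⟦ algebraOn I ⟧ h φ) →
  (d : D) (Γ : FSet σ) (φ : Formula σ) →
  (Γ ⊨⟨ algebraOn I , d ⟩ φ) ⇔ (image T Γ ⊨⟨ algebraOn I′ , d ⟩ T φ)
conservative-transfer I I′ T preserves d Γ φ = mk⇔ forward backward
  where
  forward : Γ ⊨⟨ algebraOn I , d ⟩ φ → image T Γ ⊨⟨ algebraOn I′ , d ⟩ T φ
  forward Γ⊨φ h T[Γ]↦d = trans (preserves h φ)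
    (Γ⊨φ h (λ ψ Γψ → trans (sym (preserves h ψ)) (T[Γ]↦d (T ψ) (ψ , Γψ , refl))))

  backward : image T Γ ⊨⟨ algebraOn I′ , d ⟩ T φ → Γ ⊨⟨ algebraOn I , d ⟩ φ
  backward T[Γ]⊨Tφ h Γ↦d = trans (sym (preserves h φ))
    (T[Γ]⊨Tφ h (λ { χ (ψ , Γψ , refl) → trans (preserves h ψ) (Γ↦d ψ Γψ) }))

module _ {τ : Signature} {n : ℕ} {A : FinAlgebra τ n} (C : HNFChoice A) where
  open Translation C
  open HNFChoice C

  mutual
    *-preserves-value : (h : ℕ → Fin n) (φ : Formula τ) → ⟦ 𝐧 n ⟧ h (φ *) ≡ ⟦ toAlgebra A ⟧ h φ
    *-preserves-value h (var x)    = refl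
    *-preserves-value h (app f φs) = begin
      ⟦ 𝐧 n ⟧ h (subst (lookup (φs *v)) (f °))
        ≡⟨ eval-subst (𝐧 n) h (lookup (φs *v)) (f °) ⟩
      ⟦ 𝐧 n ⟧ (λ i → ⟦ 𝐧 n ⟧ h (lookup (φs *v) i)) (f °)
        ≡⟨ °-correct f _ ⟩
      A f (tabulate (λ i → ⟦ 𝐧 n ⟧ h (lookup (φs *v) i)))
        ≡⟨ cong (A f) (tabulate-cong (*v-preserves-values h φs)) ⟩
      A f (tabulate (lookup (⟦ toAlgebra A ⟧* h φs)))
        ≡⟨ cong (A f) (tabulate∘lookup _) ⟩
      A f (⟦ toAlgebra A ⟧* h φs)
        ∎
      where open ≡-Reasoning

    *v-preserves-values : ∀ {k} (h : ℕ → Fin n) (φs : Vec (Formula τ) k) (i : Fin k) →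
                          ⟦ 𝐧 n ⟧ h (lookup (φs *v) i) ≡ lookup (⟦ toAlgebra A ⟧* h φs) i
    *v-preserves-values h (φ ∷ φs) zero    = *-preserves-value h φ
    *v-preserves-values h (φ ∷ φs) (suc i) = *v-preserves-values h φs i

theorem7p5 : (m : ℕ) (τ : Signature) (A : FinAlgebra τ (suc (suc m))) (C : HNFChoice A)
    (Γ : FSet τ) (φ : Formula τ) →
    (Γ ⊨⟨ toAlgebra A , fromℕ (suc m) ⟩ φ)
    ⇔ ((Translation._*s C Γ) ⊨⟨ 𝐧 (suc (suc m)) , fromℕ (suc m) ⟩ Translation._* C φ)
theorem7p5 m τ A C Γ φ =
  conservative-transfer A 𝐧interp (Translation._* C) (*-preserves-value C) (fromℕ (suc m)) Γ φ
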